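{- Let $v,k$ be positive integers with $v\mid k^2$ and $k\mid v$, let $\lambda=k^2/v$, and consider in $\mathbb{Z}_{v+1}$ the sets $A_{X'}=\{0,1,\ldots,k-1\}$ and $A_{Y'}=\{ak,ak+1,\ldots,ak+\lambda-1 : a=0,1,\ldots,\frac{v}{k}-1\}$. (i) If $\lambda=1$ (so $v=k^2$ and $A_{Y'}=\{0,k,\ldots,(k-1)k\}$), then the translate $k+A_{Y'}=\{k,2k,\ldots,k^2\}$ together with $A_{X'}$ forms a classical $(k^2+1,2,k,1)$-SEDF in $\mathbb{Z}_{k^2+1}$. (ii) If $\lambda>1$, then there is no $t\in\mathbb{Z}_{v+1}$ such that $\{A_{X'},t+A_{Y'}\}$ is a classical SEDF in $\mathbb{Z}_{v+1}$ (indeed $A_{X'}\cap(t+A_{Y'})\neq\emptyset$ for every $t$).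
   Context: Groups are written additively; $t+A=\{t+a:a\in A\}$. For subsets $A,B$ of a group $G$, $\Delta(A,B)$ is the multiset $\{a-b:a\in A,b\in B\}$. For a group $G$ of order $v$ and $m>1$, a family of pairwise disjoint $k$-subsets $\{A_1,\ldots,A_m\}$ of $G$ is a (classical) $(v,m,k,\lambda)$-SEDF if for each $i$ the multiset union $\bigcup_{j\neq i}\Delta(A_i,A_j)$ contains each non-zero element of $G$ exactly $\lambda$ times (and $0$ not at all). -}

module Defs where

open import Data.Nat using (ℕ; zero; suc; _+_; _*_; _∸_; _<_; NonZero)
open import Data.Nat.DivMod using (_%_; _/_)
open import Data.Nat.Properties using (_≟_)
open import Data.Fin using (Fin)
open import Data.List using (List; []; _∷_; map; concatMap; upTo; length; filter; allFin)
open import Data.Nat.ListAction using (sum)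
open import Data.List.Membership.Propositional using (_∈_; _∉_)
open import Data.List.Relation.Unary.Unique.Propositional using (Unique)
open import Data.List.Relation.Unary.All using (All)
open import Data.Product using (_×_)
open import Data.Vec.Functional using (Vector)
open import Relation.Binary.PropositionalEquality using (_≡_; _≢_)
open import Relation.Nullary using (¬_; ¬?)
open import Relation.Nullary.Decidable using (does)
open import Data.Bool using (if_then_else_)
open import Data.Fin.Properties using () renaming (_≟_ to _≟ᶠ_)

-- Elements of Z_n are represented by their canonical representatives 0,…,n-1 (naturals < n).
-- Subsets of Z_n are duplicate-free lists of such representatives; multisets are lists.

count : ℕ → List ℕ → ℕ
count x [] = 0
count x (y ∷ ys) = if does (x ≟ y) then suc (count x ys) else count x ys

subMod : (n : ℕ) .{{_ : NonZero n}} → ℕ → ℕ → ℕ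
subMod n a b = (a + (n ∸ b)) % n

translate : (n : ℕ) .{{_ : NonZero n}} → ℕ → List ℕ → List ℕ
translate n t A = map (λ a → (t + a) % n) A

Δ : (n : ℕ) .{{_ : NonZero n}} → List ℕ → List ℕ → List ℕ
Δ n A B = concatMap (λ a → map (λ b → subMod n a b) B) A

IsKSubset : (n k : ℕ) → List ℕ → Set
IsKSubset n k A = All (_< n) A × Unique A × length A ≡ k

IsSEDF : (n m k λ' : ℕ) .{{_ : NonZero n}} → Vector (List ℕ) m → Set
IsSEDF n m k λ' A =
  (1 < m) ×
  (∀ i → IsKSubset n k (A i)) ×
  (∀ i j → i ≢ j → ∀ x → x ∈ A i → x ∉ A j) ×
  (∀ i → (g : ℕ) → g < n →
     sum (map (λ j → count g (Δ n (A i) (A j)))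
              (filter (λ j → ¬? (i ≟ᶠ j)) (allFin m)))
       ≡ (if does (g ≟ 0) then 0 else λ'))

AX : ℕ → List ℕ
AX k = upTo k

lam : (v k : ℕ) .{{_ : NonZero v}} → ℕ
lam v k = (k * k) / v

AY : (v k : ℕ) .{{_ : NonZero v}} .{{_ : NonZero k}} → List ℕ
AY v k = concatMap (λ a → map (λ j → a * k + j) (upTo (lam v k))) (upTo (v / k))

pair : List ℕ → List ℕ → Vector (List ℕ) 2
pair A B Fin.zero = A
pair A B (Fin.suc _) = B

{-# OPTIONS --safe #-}
module Submission where

-- For λ = 1 we have v = k² and the translate is B = {k, 2k, …, k²}. Modulo k² + 1,
-- i − (j+1)k = 1 + i + (k−1−j)k and (j+1)k − i = 1 + (k−1−i) + jk, so after reflecting one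
-- digit both difference maps A_X' × B → ℤ_{k²+1} are the base-k numeral bijection onto
-- {1, …, k²}: every nonzero residue is a difference exactly once in each direction.
-- For λ > 1 the gaps of A_Y' in ℤ_{v+1} (k − λ between blocks, k − λ + 1 across 0) are shorter
-- than k, so every translate of A_Y' meets the interval A_X' = {0, …, k−1}, and two
-- overlapping sets never form an SEDF.

open import Defs
open import Data.Nat using (ℕ; zero; suc; _+_; _*_; _∸_; _≤_; _<_; z≤n; s≤s; z<s; _≟_; _<?_; NonZero; ≢-nonZero⁻¹; >-nonZero⁻¹)
open import Data.Nat.Properties
open import Data.Nat.DivMod
open import Data.Nat.Divisibility using (_∣_; divides; n∣m*n)
open import Data.Nat.Tactic.RingSolver using (solve-∀)
open import Data.Fin using (zero; suc)
open import Data.List using (List; []; _∷_; [_]; map; upTo)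
open import Data.List.Properties using (map-∘; map-cong-local; concatMap-map; concatMap-pure; length-map; length-upTo)
open import Data.List.Membership.Propositional using (_∈_; _∉_)
open import Data.List.Membership.Propositional.Properties using (∈-map⁺; ∈-map⁻; ∈-concat⁺′; ∈-concat⁻′; ∈-upTo⁺; ∈-upTo⁻)
open import Data.List.Relation.Unary.Any using (here; there)
import Data.List.Relation.Unary.All as All
import Data.List.Relation.Unary.All.Properties as All
open import Data.List.Relation.Unary.Unique.Propositional using (Unique; []; _∷_)
open import Data.List.Relation.Unary.Unique.Propositional.Properties using (++⁺; upTo⁺; map⁺)
open import Data.Product using (_×_; _,_; proj₁; proj₂; ∃; ∃₂)
open import Data.Product.Properties using (,-injective)
open import Data.Bool using (if_then_else_)
open import Data.Empty using (⊥-elim)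
open import Function using (_∘_)
open import Relation.Nullary using (¬_; does; yes; no)
open import Relation.Nullary.Decidable using (dec-true; dec-false)
open import Relation.Binary.PropositionalEquality using (_≡_; _≢_; refl; sym; trans; cong; cong₂; subst; module ≡-Reasoning)

count-≡ : ∀ x ys → count x (x ∷ ys) ≡ suc (count x ys)
count-≡ x ys = cong (λ b → if b then suc (count x ys) else count x ys) (dec-true (x ≟ x) refl)

count-≢ : ∀ {x y} ys → x ≢ y → count x (y ∷ ys) ≡ count x ys
count-≢ {x} {y} ys x≢y = cong (λ b → if b then suc (count x ys) else count x ys) (dec-false (x ≟ y) x≢y)

count-∉ : ∀ {x xs} → x ∉ xs → count x xs ≡ 0
count-∉ {xs = []} _ = refl
count-∉ {x} {y ∷ ys} x∉ = trans (count-≢ ys (x∉ ∘ here)) (count-∉ {xs = ys} (x∉ ∘ there))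

count-∈-unique : ∀ {x xs} → Unique xs → x ∈ xs → count x xs ≡ 1
count-∈-unique {x} {_ ∷ ys} (y∉ys ∷ _) (here refl) =
  trans (count-≡ x ys) (cong suc (count-∉ λ x∈ys → All.lookup y∉ys x∈ys refl))
count-∈-unique {x} {y ∷ ys} (y∉ys ∷ ys!) (there x∈ys) =
  trans (count-≢ ys λ {refl → All.lookup y∉ys x∈ys refl}) (count-∈-unique ys! x∈ys)

unique-map-local : ∀ {A B : Set} {f : A → B} {xs} → Unique xs →
                   (∀ {x y} → x ∈ xs → y ∈ xs → f x ≡ f y → x ≡ y) → Unique (map f xs)
unique-map-local [] _ = []
unique-map-local (x∉xs ∷ xs!) f-inj =
  All.map⁺ (All.tabulate λ y∈xs fx≡fy → All.lookup x∉xs y∈xs (f-inj (here refl) (there y∈xs) fx≡fy))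
  ∷ unique-map-local xs! (λ x∈ y∈ → f-inj (there x∈) (there y∈))

module _ (n : ℕ) .{{_ : NonZero n}} where

  ∈-Δ⁺ : ∀ {A B a b} → a ∈ A → b ∈ B → subMod n a b ∈ Δ n A B
  ∈-Δ⁺ {B = B} a∈A b∈B = ∈-concat⁺′ (∈-map⁺ (subMod n _) b∈B) (∈-map⁺ (λ a → map (subMod n a) B) a∈A)

  ∈-Δ⁻ : ∀ A B {g} → g ∈ Δ n A B → ∃₂ λ a b → a ∈ A × b ∈ B × g ≡ subMod n a b
  ∈-Δ⁻ A B g∈Δ with ∈-concat⁻′ (map (λ a → map (subMod n a) B) A) g∈Δ
  ... | row , g∈row , row∈ with ∈-map⁻ (λ a → map (subMod n a) B) row∈
  ... | a , a∈A , refl with ∈-map⁻ (subMod n a) g∈row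
  ... | b , b∈B , g≡a-b = a , b , a∈A , b∈B , g≡a-b

  DistinctDifferences : List ℕ → List ℕ → Set
  DistinctDifferences A B = ∀ {a a′ b b′} → a ∈ A → a′ ∈ A → b ∈ B → b′ ∈ B →
                            subMod n a b ≡ subMod n a′ b′ → a ≡ a′ × b ≡ b′

  unique-Δ : ∀ {A B} → Unique A → Unique B → DistinctDifferences A B → Unique (Δ n A B)
  unique-Δ [] _ _ = []
  unique-Δ {a ∷ A} {B} (a∉A ∷ A!) B! distinct =
    ++⁺ (unique-map-local B! λ b∈ b′∈ → proj₂ ∘ distinct (here refl) (here refl) b∈ b′∈)
        (unique-Δ A! B! λ a∈ a′∈ → distinct (there a∈) (there a′∈))
        row-disjoint
    where
    row-disjoint : ∀ {g} → ¬ (g ∈ map (subMod n a) B × g ∈ Δ n A B)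
    row-disjoint (g∈row , g∈Δ) with ∈-map⁻ (subMod n a) g∈row | ∈-Δ⁻ A B g∈Δ
    ... | b , b∈B , refl | a′ , b′ , a′∈A , b′∈B , e =
      All.lookup a∉A a′∈A (proj₁ (distinct (here refl) (there a′∈A) b∈B b′∈B e))

count-nonzero-once : ∀ {n D} → Unique D → 0 ∉ D → (∀ {g} → suc g < n → suc g ∈ D) →
                     ∀ g → g < n → count g D ≡ (if does (g ≟ 0) then 0 else 1)
count-nonzero-once _ 0∉D _ zero _ = count-∉ 0∉D
count-nonzero-once D! _ cover (suc g) 1+g<n = count-∈-unique D! (cover 1+g<n)

count-Δ-bijective : ∀ v {A B} (decode : ℕ → ℕ × ℕ) → Unique A → Unique B →
  (∀ {a b} → a ∈ A → b ∈ B → ∃ λ g → subMod (suc v) a b ≡ suc g × decode g ≡ (a , b)) →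
  (∀ {g} → g < v → let (a , b) = decode g in a ∈ A × b ∈ B × subMod (suc v) a b ≡ suc g) →
  ∀ g → g < suc v → count g (Δ (suc v) A B) ≡ (if does (g ≟ 0) then 0 else 1)
count-Δ-bijective v {A} {B} decode A! B! encode decode-sound =
  count-nonzero-once (unique-Δ (suc v) A! B! distinct) zero∉Δ cover
  where
  zero∉Δ : 0 ∉ Δ (suc v) A B
  zero∉Δ 0∈Δ with ∈-Δ⁻ (suc v) A B 0∈Δ
  ... | a , b , a∈A , b∈B , 0≡a-b with encode a∈A b∈B
  ... | _ , a-b≡1+g , _ = 1+n≢0 (trans (sym a-b≡1+g) (sym 0≡a-b))
  distinct : DistinctDifferences (suc v) A B
  distinct a∈A a′∈A b∈B b′∈B a-b≡a′-b′ with encode a∈A b∈B | encode a′∈A b′∈B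
  ... | g , a-b≡1+g , dec-g | g′ , a′-b′≡1+g′ , dec-g′ =
    ,-injective (trans (sym dec-g) (trans (cong decode g≡g′) dec-g′))
    where
    g≡g′ : g ≡ g′
    g≡g′ = suc-injective (trans (sym a-b≡1+g) (trans a-b≡a′-b′ a′-b′≡1+g′))
  cover : ∀ {g} → suc g < suc v → suc g ∈ Δ (suc v) A B
  cover (s≤s g<v) with decode-sound g<v
  ... | a∈A , b∈B , a-b≡1+g = subst (_∈ Δ (suc v) A B) a-b≡1+g (∈-Δ⁺ (suc v) a∈A b∈B)

module _ (n : ℕ) .{{_ : NonZero n}} where

  subMod-≥ : ∀ {a b} → b ≤ a → a < n → subMod n a b ≡ a ∸ b
  subMod-≥ {a} {b} b≤a a<n = begin
    (a + (n ∸ b)) % n           ≡⟨ cong (λ x → (x + (n ∸ b)) % n) (sym (m∸n+n≡m b≤a)) ⟩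
    (a ∸ b + b + (n ∸ b)) % n   ≡⟨ cong (_% n) (+-assoc (a ∸ b) b (n ∸ b)) ⟩
    (a ∸ b + (b + (n ∸ b))) % n ≡⟨ cong (λ x → (a ∸ b + x) % n) (m+[n∸m]≡n (≤-trans b≤a (<⇒≤ a<n))) ⟩
    (a ∸ b + n) % n             ≡⟨ [m+n]%n≡m%n (a ∸ b) n ⟩
    (a ∸ b) % n                 ≡⟨ m<n⇒m%n≡m (≤-<-trans (m∸n≤m a b) a<n) ⟩
    a ∸ b                       ∎
    where open ≡-Reasoning

  subMod-< : ∀ {a b} → a < b → b ≤ n → subMod n a b ≡ a + (n ∸ b)
  subMod-< {a} {b} a<b b≤n =
    m<n⇒m%n≡m (subst (a + (n ∸ b) <_) (m+[n∸m]≡n b≤n) (+-monoˡ-< (n ∸ b) a<b))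

module _ (k : ℕ) .{{_ : NonZero k}} where

  digits-% : ∀ {r} a → r < k → (r + a * k) % k ≡ r
  digits-% {r} a r<k = trans ([m+kn]%n≡m%n r a k) (m<n⇒m%n≡m r<k)

  digits-/ : ∀ {r} a → r < k → (r + a * k) / k ≡ a
  digits-/ {r} a r<k = begin
    (r + a * k) / k     ≡⟨ +-distrib-/-∣ʳ r (n∣m*n a) ⟩
    r / k + a * k / k   ≡⟨ cong₂ _+_ (m<n⇒m/n≡0 r<k) (m*n/n≡m a k) ⟩
    a                   ∎
    where open ≡-Reasoning

reflect-< : ∀ {j k} → j < k → k ∸ suc j < k
reflect-< {j} (s≤s j≤k′) = s≤s (m∸n≤m _ j)

reflect-involutive : ∀ {j k} → j < k → k ∸ suc (k ∸ suc j) ≡ j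
reflect-involutive (s≤s j≤k′) = m∸[m∸n]≡n j≤k′

∸-reflect : ∀ {i k} → i < k → k ∸ i ≡ suc (k ∸ suc i)
∸-reflect (s≤s i≤k′) = +-∸-assoc 1 i≤k′

module SquareOrder (v k : ℕ) .{{_ : NonZero v}} .{{_ : NonZero k}} (v≡k*k : v ≡ k * k) where

  n : ℕ
  n = suc v

  β : ℕ → ℕ
  β j = suc j * k

  B : List ℕ
  B = map β (upTo k)

  β-≤ : ∀ {j} → j < k → β j ≤ v
  β-≤ {j} j<k = subst (β j ≤_) (sym v≡k*k) (*-monoˡ-≤ k j<k)

  B! : Unique B
  B! = map⁺ (λ {i} {j} βi≡βj → suc-injective (*-cancelʳ-≡ (suc i) (suc j) k βi≡βj)) (upTo⁺ k)

  translate-AY : translate n k (AY v k) ≡ B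
  translate-AY = begin
    translate n k (AY v k)
      ≡⟨ cong (translate n k) AY≡ ⟩
    map (λ a → (k + a) % n) (map (λ a → a * k + 0) (upTo k))
      ≡⟨ sym (map-∘ (upTo k)) ⟩
    map (λ a → (k + (a * k + 0)) % n) (upTo k)
      ≡⟨ map-cong-local (All.tabulate (λ j∈ → shift (∈-upTo⁻ j∈))) ⟩
    B ∎
    where
    open ≡-Reasoning
    λ≡1 : lam v k ≡ 1
    λ≡1 = trans (cong (_/ v) (sym v≡k*k)) (n/n≡1 v)
    v/k≡k : v / k ≡ k
    v/k≡k = trans (cong (_/ k) v≡k*k) (m*n/n≡m k k)
    AY≡ : AY v k ≡ map (λ a → a * k + 0) (upTo k)
    AY≡ rewrite λ≡1 | v/k≡k =
      trans (sym (concatMap-map [_] (λ a → a * k + 0) (upTo k))) (concatMap-pure _)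
    shift : ∀ {j} → j < k → (k + (j * k + 0)) % n ≡ β j
    shift {j} j<k =
      trans (cong (λ x → (k + x) % n) (+-identityʳ (j * k))) (m<n⇒m%n≡m (s≤s (β-≤ j<k)))

  AX−B : ∀ {i j} → i < k → j < k → subMod n i (β j) ≡ suc (i + (k ∸ suc j) * k)
  AX−B {i} {j} i<k j<k = begin
    subMod n i (β j)              ≡⟨ subMod-< n (<-≤-trans i<k (m≤m+n k (j * k))) (m≤n⇒m≤1+n (β-≤ j<k)) ⟩
    i + (n ∸ β j)                 ≡⟨ cong (i +_) (+-∸-assoc 1 (β-≤ j<k)) ⟩
    i + suc (v ∸ β j)             ≡⟨ +-suc i (v ∸ β j) ⟩
    suc (i + (v ∸ β j))           ≡⟨ cong (λ x → suc (i + (x ∸ β j))) v≡k*k ⟩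
    suc (i + (k * k ∸ β j))       ≡⟨ cong (λ x → suc (i + x)) (sym (*-distribʳ-∸ k k (suc j))) ⟩
    suc (i + (k ∸ suc j) * k)     ∎
    where open ≡-Reasoning

  B−AX : ∀ {i j} → i < k → j < k → subMod n (β j) i ≡ suc ((k ∸ suc i) + j * k)
  B−AX {i} {j} i<k j<k = begin
    subMod n (β j) i              ≡⟨ subMod-≥ n (≤-trans (<⇒≤ i<k) (m≤m+n k (j * k))) (s≤s (β-≤ j<k)) ⟩
    k + j * k ∸ i                 ≡⟨ +-∸-comm (j * k) (<⇒≤ i<k) ⟩
    (k ∸ i) + j * k               ≡⟨ cong (_+ j * k) (∸-reflect i<k) ⟩
    suc ((k ∸ suc i) + j * k)     ∎
    where open ≡-Reasoning

  quotient-< : ∀ {g} → g < v → g / k < k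
  quotient-< g<v = m<n*o⇒m/o<n (subst (_ <_) v≡k*k g<v)

  count-AX−B : ∀ g → g < n → count g (Δ n (upTo k) B) ≡ (if does (g ≟ 0) then 0 else 1)
  count-AX−B = count-Δ-bijective v decode (upTo⁺ k) B! encode decode-sound
    where
    decode : ℕ → ℕ × ℕ
    decode g = g % k , β (k ∸ suc (g / k))
    encode : ∀ {a b} → a ∈ upTo k → b ∈ B → ∃ λ g → subMod n a b ≡ suc g × decode g ≡ (a , b)
    encode {a} a∈ b∈ with ∈-upTo⁻ a∈ | ∈-map⁻ β b∈
    ... | a<k | j , j∈ , refl = a + (k ∸ suc j) * k , AX−B a<k j<k ,
      cong₂ _,_ (digits-% k (k ∸ suc j) a<k)
                (cong β (trans (cong (λ x → k ∸ suc x) (digits-/ k (k ∸ suc j) a<k))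
                               (reflect-involutive j<k)))
      where
      j<k : j < k
      j<k = ∈-upTo⁻ j∈
    decode-sound : ∀ {g} → g < v → let (a , b) = decode g in a ∈ upTo k × b ∈ B × subMod n a b ≡ suc g
    decode-sound {g} g<v = ∈-upTo⁺ (m%n<n g k) , ∈-map⁺ β (∈-upTo⁺ (reflect-< q<k)) , (begin
      subMod n (g % k) (β (k ∸ suc (g / k)))
        ≡⟨ AX−B (m%n<n g k) (reflect-< q<k) ⟩
      suc (g % k + (k ∸ suc (k ∸ suc (g / k))) * k)
        ≡⟨ cong (λ x → suc (g % k + x * k)) (reflect-involutive q<k) ⟩
      suc (g % k + g / k * k)
        ≡⟨ cong suc (sym (m≡m%n+[m/n]*n g k)) ⟩
      suc g ∎)
      where
      open ≡-Reasoning
      q<k : g / k < k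
      q<k = quotient-< g<v

  count-B−AX : ∀ g → g < n → count g (Δ n B (upTo k)) ≡ (if does (g ≟ 0) then 0 else 1)
  count-B−AX = count-Δ-bijective v decode B! (upTo⁺ k) encode decode-sound
    where
    decode : ℕ → ℕ × ℕ
    decode g = β (g / k) , k ∸ suc (g % k)
    encode : ∀ {a b} → a ∈ B → b ∈ upTo k → ∃ λ g → subMod n a b ≡ suc g × decode g ≡ (a , b)
    encode {b = i} a∈ i∈ with ∈-map⁻ β a∈ | ∈-upTo⁻ i∈
    ... | j , j∈ , refl | i<k = k ∸ suc i + j * k , B−AX i<k (∈-upTo⁻ j∈) ,
      cong₂ _,_ (cong β (digits-/ k j (reflect-< i<k)))
                (trans (cong (λ x → k ∸ suc x) (digits-% k j (reflect-< i<k))) (reflect-involutive i<k))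
    decode-sound : ∀ {g} → g < v → let (a , b) = decode g in a ∈ B × b ∈ upTo k × subMod n a b ≡ suc g
    decode-sound {g} g<v = ∈-map⁺ β (∈-upTo⁺ q<k) , ∈-upTo⁺ (reflect-< (m%n<n g k)) , (begin
      subMod n (β (g / k)) (k ∸ suc (g % k))
        ≡⟨ B−AX (reflect-< (m%n<n g k)) q<k ⟩
      suc (k ∸ suc (k ∸ suc (g % k)) + g / k * k)
        ≡⟨ cong (λ x → suc (x + g / k * k)) (reflect-involutive (m%n<n g k)) ⟩
      suc (g % k + g / k * k)
        ≡⟨ cong suc (sym (m≡m%n+[m/n]*n g k)) ⟩
      suc g ∎)
      where
      open ≡-Reasoning
      q<k : g / k < k
      q<k = quotient-< g<v

  AX-B-SEDF : IsSEDF n 2 k 1 (pair (upTo k) B)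
  AX-B-SEDF = s≤s (s≤s z≤n) , k-subset , disjoint , λ
    { zero g g<n → trans (+-identityʳ _) (count-AX−B g g<n)
    ; (suc zero) g g<n → trans (+-identityʳ _) (count-B−AX g g<n)
    }
    where
    k<n : k < n
    k<n = s≤s (subst (k ≤_) (sym v≡k*k) (m≤m*n k k))
    k≤B : ∀ {b} → b ∈ B → k ≤ b
    k≤B b∈ with ∈-map⁻ β b∈
    ... | j , _ , refl = m≤m+n k (j * k)
    k-subset : ∀ i → IsKSubset n k (pair (upTo k) B i)
    k-subset zero = All.tabulate (λ a∈ → <-trans (∈-upTo⁻ a∈) k<n) , upTo⁺ k , length-upTo k
    k-subset (suc zero) = All.tabulate b<n , B! , trans (length-map β (upTo k)) (length-upTo k)
      where
      b<n : ∀ {b} → b ∈ B → b < n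
      b<n b∈ with ∈-map⁻ β b∈
      ... | j , j∈ , refl = s≤s (β-≤ (∈-upTo⁻ j∈))
    disjoint : ∀ i j → i ≢ j → ∀ x → x ∈ pair (upTo k) B i → x ∉ pair (upTo k) B j
    disjoint zero zero i≢j = ⊥-elim (i≢j refl)
    disjoint zero (suc zero) _ x x∈AX x∈B = <⇒≱ (∈-upTo⁻ x∈AX) (k≤B x∈B)
    disjoint (suc zero) zero _ x x∈B x∈AX = <⇒≱ (∈-upTo⁻ x∈AX) (k≤B x∈B)
    disjoint (suc zero) (suc zero) i≢j = ⊥-elim (i≢j refl)

  SEDF : IsSEDF n 2 k 1 (pair (AX k) (translate n k (AY v k)))
  SEDF = subst (λ B′ → IsSEDF n 2 k 1 (pair (AX k) B′)) (sym translate-AY) AX-B-SEDF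

∈-translate : ∀ n .{{_ : NonZero n}} t {x y A} → y ∈ A → (t + y) % n ≡ x → x ∈ translate n t A
∈-translate n t y∈A t+y≡x = subst (_∈ _) t+y≡x (∈-map⁺ (λ a → (t + a) % n) y∈A)

∈-AY : ∀ {v k} .{{_ : NonZero v}} .{{_ : NonZero k}} {a j} →
       a < v / k → j < lam v k → a * k + j ∈ AY v k
∈-AY {v} {k} {a} a<q j<λ =
  ∈-concat⁺′ (∈-map⁺ (a * k +_) (∈-upTo⁺ j<λ))
             (∈-map⁺ (λ a → map (a * k +_) (upTo (lam v k))) (∈-upTo⁺ a<q))

module Overlap (v k : ℕ) .{{_ : NonZero v}} .{{_ : NonZero k}}
               (q : ℕ) (v≡q*k : v ≡ q * k) (1<λ : 1 < lam v k) where

  n : ℕ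
  n = suc v

  ∈-AY′ : ∀ {a j} → a < q → j < lam v k → a * k + j ∈ AY v k
  ∈-AY′ a<q = ∈-AY (subst (_ <_) (sym v/k≡q) a<q)
    where
    v/k≡q : v / k ≡ q
    v/k≡q = trans (cong (_/ k) v≡q*k) (m*n/n≡m q k)

  0<λ : 0 < lam v k
  0<λ = <-trans z<s 1<λ

  meets-small-shift : ∀ {t} → t < k → t ≤ v → ∃ λ x → x ∈ upTo k × x ∈ translate n t (AY v k)
  meets-small-shift {t} t<k t≤v = t , ∈-upTo⁺ t<k ,
    ∈-translate n t (∈-AY′ {0} {0} 0<q 0<λ)
      (trans (cong (_% n) (+-identityʳ t)) (m<n⇒m%n≡m (s≤s t≤v)))
    where
    0<q : 0 < q
    0<q = n≢0⇒n>0 λ {refl → ≢-nonZero⁻¹ v v≡q*k}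

  -- With v − t = r + a k, the residue −t = v − t + 1 lies in block a when r + 1 < λ;
  -- otherwise r ≥ 1, so block a + 1 exists, and it starts k − 1 − r steps after −t.
  module LargeShift {t} (k≤t : k ≤ t) (t≤v : t ≤ v) where

    s r a : ℕ
    s = v ∸ t
    r = s % k
    a = s / k

    r<k : r < k
    r<k = m%n<n s k

    t+r+ak≡v : t + (r + a * k) ≡ v
    t+r+ak≡v = trans (cong (t +_) (sym (m≡m%n+[m/n]*n s k))) (m+[n∸m]≡n t≤v)

    r+next-block≤v : r + suc a * k ≤ v
    r+next-block≤v = subst (r + suc a * k ≤_) t+r+ak≡v
      (subst (_≤ t + (r + a * k)) (swap-k r (a * k) k) (+-monoˡ-≤ (r + a * k) k≤t))
      where
      swap-k : ∀ r ak k → k + (r + ak) ≡ r + (k + ak)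
      swap-k = solve-∀

    1+a≤q : suc a ≤ q
    1+a≤q = *-cancelʳ-≤ (suc a) q k (subst (suc a * k ≤_) v≡q*k (≤-trans (m≤n+m _ r) r+next-block≤v))

    wraps-to-zero : (t + (a * k + suc r)) % n ≡ 0
    wraps-to-zero = begin
      (t + (a * k + suc r)) % n  ≡⟨ cong (_% n) (rearrange t (a * k) r) ⟩
      suc (t + (r + a * k)) % n  ≡⟨ cong (λ y → suc y % n) t+r+ak≡v ⟩
      n % n                      ≡⟨ n%n≡0 n ⟩
      0                          ∎
      where
      open ≡-Reasoning
      rearrange : ∀ t ak r → t + (ak + suc r) ≡ suc (t + (r + ak))
      rearrange = solve-∀

    x : ℕ
    x = k ∸ suc r

    x<k : x < k
    x<k = reflect-< r<k

    lands-at-x : (t + (suc a * k + 0)) % n ≡ x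
    lands-at-x = begin
      (t + (k + a * k + 0)) % n          ≡⟨ cong (λ y → (t + (y + a * k + 0)) % n) k≡r+1+x ⟩
      (t + (r + suc x + a * k + 0)) % n  ≡⟨ cong (_% n) (rearrange t (a * k) r x) ⟩
      (x + suc (t + (r + a * k))) % n    ≡⟨ cong (λ y → (x + suc y) % n) t+r+ak≡v ⟩
      (x + n) % n                        ≡⟨ [m+n]%n≡m%n x n ⟩
      x % n                              ≡⟨ m<n⇒m%n≡m (<-≤-trans x<k (≤-trans k≤t (m≤n⇒m≤1+n t≤v))) ⟩
      x                                  ∎
      where
      open ≡-Reasoning
      k≡r+1+x : k ≡ r + suc x
      k≡r+1+x = trans (sym (m+[n∸m]≡n (<⇒≤ r<k))) (cong (r +_) (∸-reflect r<k))
      rearrange : ∀ t ak r x → t + (r + suc x + ak + 0) ≡ x + suc (t + (r + ak))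
      rearrange = solve-∀

    meets : ∃ λ x → x ∈ upTo k × x ∈ translate n t (AY v k)
    meets with suc r <? lam v k
    ... | yes 1+r<λ = 0 , ∈-upTo⁺ (>-nonZero⁻¹ k) , ∈-translate n t (∈-AY′ 1+a≤q 1+r<λ) wraps-to-zero
    ... | no 1+r≮λ = x , ∈-upTo⁺ x<k , ∈-translate n t (∈-AY′ {suc a} {0} 1+a<q 0<λ) lands-at-x
      where
      r≢0 : r ≢ 0
      r≢0 r≡0 = 1+r≮λ (subst (λ y → suc y < lam v k) (sym r≡0) 1<λ)
      1+a<q : suc a < q
      1+a<q = ≤∧≢⇒< 1+a≤q λ 1+a≡q → r≢0 (n≤0⇒n≡0 (+-cancelʳ-≤ (q * k) r 0
                (subst (λ y → r + y * k ≤ q * k) 1+a≡q (subst (r + suc a * k ≤_) v≡q*k r+next-block≤v))))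

  AX-meets-translate : ∀ t → t ≤ v → ∃ λ x → x ∈ upTo k × x ∈ translate n t (AY v k)
  AX-meets-translate t t≤v with t <? k
  ... | yes t<k = meets-small-shift t<k t≤v
  ... | no t≮k = LargeShift.meets (≮⇒≥ t≮k) t≤v

overlap⇒¬SEDF : ∀ {n k μ A B} .{{_ : NonZero n}} →
                (∃ λ x → x ∈ A × x ∈ B) → ¬ IsSEDF n 2 k μ (pair A B)
overlap⇒¬SEDF (x , x∈A , x∈B) (_ , _ , disjoint , _) = disjoint zero (suc zero) (λ ()) x x∈A x∈B

λ≡1⇒square : ∀ v k ℓ .{{_ : NonZero v}} → k * k ≡ ℓ * v → lam v k ≡ 1 → v ≡ k * k
λ≡1⇒square v k ℓ k*k≡ℓv λ≡1 = begin
  v       ≡⟨ sym (*-identityˡ v) ⟩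
  1 * v   ≡⟨ cong (_* v) (sym ℓ≡1) ⟩
  ℓ * v   ≡⟨ sym k*k≡ℓv ⟩
  k * k   ∎
  where
  open ≡-Reasoning
  ℓ≡1 : ℓ ≡ 1
  ℓ≡1 = trans (sym (m*n/n≡m ℓ v)) (trans (cong (_/ v) (sym k*k≡ℓv)) λ≡1)

mainTheorem11 : (v k : ℕ) .{{_ : NonZero v}} .{{_ : NonZero k}} →
    v ∣ k * k → k ∣ v →
    (lam v k ≡ 1 →
       IsSEDF (suc v) 2 k 1 (pair (AX k) (translate (suc v) k (AY v k))))
    × (1 < lam v k →
       ∀ t → t < suc v →
         (∃ λ x → x ∈ AX k × x ∈ translate (suc v) t (AY v k))
         × (∀ μ → ¬ IsSEDF (suc v) 2 k μ (pair (AX k) (translate (suc v) t (AY v k)))))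
mainTheorem11 v k (divides ℓ k*k≡ℓv) (divides q v≡q*k) = square-case , overlap-case
  where
  square-case : lam v k ≡ 1 → IsSEDF (suc v) 2 k 1 (pair (AX k) (translate (suc v) k (AY v k)))
  square-case λ≡1 = SquareOrder.SEDF v k (λ≡1⇒square v k ℓ k*k≡ℓv λ≡1)
  overlap-case : 1 < lam v k → ∀ t → t < suc v →
    (∃ λ x → x ∈ AX k × x ∈ translate (suc v) t (AY v k))
    × (∀ μ → ¬ IsSEDF (suc v) 2 k μ (pair (AX k) (translate (suc v) t (AY v k))))
  overlap-case 1<λ t (s≤s t≤v) = meet , λ _ → overlap⇒¬SEDF meet
    where
    meet : ∃ λ x → x ∈ AX k × x ∈ translate (suc v) t (AY v k)
    meet = Overlap.AX-meets-translate v k q v≡q*k 1<λ t t≤v
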